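{- $S(\mathbb{F}_q[t])=t\,\mathbb{F}_q[t]$; that is, the set of values of $S$ is exactly the set of polynomials divisible by $t$ (including $0$).
   Context: Let $\mathbb{F}_q$ be a finite field with $q$ elements ($q$ a prime power). Fix an enumeration $\mathbb{F}_q=\{a_0,a_1,\dots,a_{q-1}\}$ with $a_0=0$, $a_1=1$. Every nonzero $f\in\mathbb{F}_q[t]$ of degree $m$ is uniquely written $f=a_{i_0}+a_{i_1}t+\dots+a_{i_m}t^m$ with $0\le i_j\le q-1$, $a_{i_m}\neq 0$. Put $\delta(f)=i_0+i_1q+\dots+i_mq^m$ and $\delta(0)=0$. Order $\mathbb{F}_q[t]$ by: $f>g$ iff $\delta(f)>\delta(g)$. For nonzero $f$, $f!=\prod_{g<f}(f-g)$ (product over all $g\in\mathbb{F}_q[t]$ with $g<f$), and $0!=1$. For nonzero $f$, $S(f)$ is the smallest $g$ (in this order) with $f\mid g!$; $S(0)=0$. -}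

module Defs where

open import Data.Nat using (ℕ; zero; suc; _+_; _*_; _<_; _≤_)
open import Data.Nat.DivMod using (_%_; _/_; m%n<n)
open import Data.Fin using (Fin; toℕ; fromℕ<) renaming (zero to fzero; suc to fsuc)
open import Data.Fin.Properties using () renaming (_≟_ to _≟ᶠ_)
open import Data.List using (List; []; _∷_; map; foldr; upTo)
open import Data.Product using (Σ; ∃; _×_; _,_)
open import Data.Unit using (⊤)
open import Relation.Nullary using (¬_; yes; no)
open import Relation.Binary.PropositionalEquality using (_≡_; _≢_)
open import Algebra.Core using (Op₁; Op₂)
open import Algebra.Structures using (IsCommutativeRing)

-- A finite field with q elements, together with the enumeration
-- F_q = {a_0,...,a_{q-1}}: we take the carrier to be Fin q itself, so that
-- a_i is the element of Fin q with index i.  The standing convention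
-- a_0 = 0, a_1 = 1 is imposed by the fields zero-index / one-index.
record FiniteField (q : ℕ) : Set where
  field
    _+F_ _*F_   : Op₂ (Fin q)
    -F_         : Op₁ (Fin q)
    0F 1F       : Fin q
    isCommRing  : IsCommutativeRing _≡_ _+F_ _*F_ -F_ 0F 1F
    0≢1         : 0F ≢ 1F
    inverse     : ∀ x → x ≢ 0F → ∃ λ y → x *F y ≡ 1F
    zero-index  : toℕ 0F ≡ 0
    one-index   : toℕ 1F ≡ 1

-- base-q digits of n, lowest first (fuel = n suffices)
digitsFuel : (q : ℕ) → ℕ → ℕ → List (Fin q)
digitsFuel zero    _       _          = []
digitsFuel (suc p) zero    _          = []
digitsFuel (suc p) (suc k) zero       = []
digitsFuel (suc p) (suc k) n@(suc _)  = fromℕ< (m%n<n n (suc p)) ∷ digitsFuel (suc p) k (n / suc p)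

module Poly {q : ℕ} (F : FiniteField q) where
  open FiniteField F

  -- A polynomial a_{i_0} + a_{i_1} t + ... is the list of coefficients,
  -- lowest degree first.  Genuine polynomials are the lists with no
  -- trailing zero coefficient (the zero polynomial is []).
  Normal : List (Fin q) → Set
  Normal []           = ⊤
  Normal (a ∷ [])     = a ≢ 0F
  Normal (_ ∷ b ∷ l)  = Normal (b ∷ l)

  cons : Fin q → List (Fin q) → List (Fin q)
  cons a [] with a ≟ᶠ 0F
  ... | yes _ = []
  ... | no  _ = a ∷ []
  cons a (b ∷ l) = a ∷ b ∷ l

  norm : List (Fin q) → List (Fin q)
  norm = foldr cons []

  addL : List (Fin q) → List (Fin q) → List (Fin q)
  addL []      g       = g
  addL (a ∷ f) []      = a ∷ f
  addL (a ∷ f) (b ∷ g) = (a +F b) ∷ addL f g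

  mulL : List (Fin q) → List (Fin q) → List (Fin q)
  mulL []      g = []
  mulL (a ∷ f) g = addL (map (a *F_) g) (0F ∷ mulL f g)

  _⊕_ : List (Fin q) → List (Fin q) → List (Fin q)
  f ⊕ g = norm (addL f g)

  ⊖_ : List (Fin q) → List (Fin q)
  ⊖ f = norm (map -F_ f)

  _⊝_ : List (Fin q) → List (Fin q) → List (Fin q)
  f ⊝ g = f ⊕ (⊖ g)

  _⊗_ : List (Fin q) → List (Fin q) → List (Fin q)
  f ⊗ g = norm (mulL f g)

  one : List (Fin q)
  one = 1F ∷ []

  tPoly : List (Fin q)
  tPoly = 0F ∷ 1F ∷ []

  _∣P_ : List (Fin q) → List (Fin q) → Set
  f ∣P g = ∃ λ h → f ⊗ h ≡ g

  δ : List (Fin q) → ℕ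
  δ = foldr (λ a acc → toℕ a + q * acc) 0

  decodeFuel : ℕ → ℕ → List (Fin q)
  decodeFuel = digitsFuel q
  -- decode n is the unique polynomial g with δ(g) = n
  decode : ℕ → List (Fin q)
  decode n = decodeFuel n n

  -- f! = ∏_{g < f} (f - g); the g with g < f are exactly decode n, n < δ f.
  -- (empty product, e.g. for f = 0, is 1)
  fact : List (Fin q) → List (Fin q)
  fact f = foldr _⊗_ one (map (λ n → f ⊝ decode n) (upTo (δ f)))

  -- IsS f g :  g = S(f)  (for polynomials f, g)
  IsS : List (Fin q) → List (Fin q) → Set
  IsS f g =
    (f ≡ [] → g ≡ []) ×
    (f ≢ [] → (f ∣P fact g) ×
              (∀ h → Normal h → f ∣P fact h → δ g ≤ δ h))

{-# OPTIONS --safe #-}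
-- Write g = c + t x with constant term c, and T = t x.  In the order δ the polynomials below g
-- are those below T, which come in blocks of q agreeing outside the constant coefficient,
-- followed by the c polynomials a_i + t x (i < c).  Within a block the constant terms of g - h
-- and of T - h both run over all of F_q, so the block contributes the same product to g! and
-- to T!; the remaining factors of g! are the constants c - a_i.  Hence g! = T! · unit, and if
-- c ≠ 0 any f dividing g! already divides T! with T < g, so g ≠ S(f).
-- Conversely, the degree E(N) (degFact) of the factorial of the polynomial with δ = N satisfies
-- E(Aq + c) = q (A + E(A)), so E is monotone and E(M) < E(Uq) for M < Uq.  If t ∣ g then
-- δ g = Uq, and comparing degrees shows that g! divides no h! with h < g: g = S(g!).
module Submission where

open import Defs
open import Algebra.Bundles using (CommutativeMonoid; CommutativeRing)
open import Algebra.Structures using (IsCommutativeRing)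
open import Data.Empty using (⊥; ⊥-elim)
open import Data.Fin using (Fin; toℕ; fromℕ<)
open import Data.Fin.Permutation using (Permutation; permutation; _⟨$⟩ʳ_)
open import Data.Fin.Properties using (toℕ<n; toℕ-injective; toℕ-fromℕ<) renaming (_≟_ to _≟ᶠ_)
open import Data.List using (List; []; _∷_; map; foldr; length; drop; applyUpTo)
open import Data.Nat using (ℕ; zero; suc; _+_; _*_; _∸_; _<_; _≤_; z≤n; s≤s)
import Data.Nat.Properties as ℕ
open import Data.List.Properties using (map-upTo)
open import Data.Nat.DivMod
open import Data.Nat.Divisibility using (divides-refl)
open import Data.Nat.Induction using (<-rec)
open import Data.Product using (∃; _×_; _,_; proj₁; proj₂)
open import Data.Unit using (tt)
open import Function using (_∘_; flip)
open import Level using (0ℓ)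
open import Relation.Binary.Bundles using (Setoid)
import Relation.Binary.Reasoning.Setoid as SetoidReasoning
open import Relation.Binary.PropositionalEquality
  using (_≡_; _≢_; refl; sym; trans; cong; cong₂; subst; subst₂; module ≡-Reasoning)
open import Relation.Nullary using (yes; no)

module RangeProduct {c ℓ} (M : CommutativeMonoid c ℓ) where
  open CommutativeMonoid M renaming (refl to ≈-refl; sym to ≈-sym; trans to ≈-trans)
  open import Algebra.Properties.CommutativeMonoid.Sum M using (sum; sum-permute; sum-cong-≋)
  open SetoidReasoning setoid

  ∏ : ℕ → (ℕ → Carrier) → Carrier
  ∏ zero    F = ε
  ∏ (suc n) F = F 0 ∙ ∏ n (F ∘ suc)

  ∏-cong : ∀ n {F G} → (∀ i → i < n → F i ≈ G i) → ∏ n F ≈ ∏ n G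
  ∏-cong zero    F≈G = ≈-refl
  ∏-cong (suc n) F≈G = ∙-cong (F≈G 0 (s≤s z≤n)) (∏-cong n (λ i i<n → F≈G (suc i) (s≤s i<n)))

  ∏-+ : ∀ m n F → ∏ (m + n) F ≈ ∏ m F ∙ ∏ n (λ i → F (m + i))
  ∏-+ zero    n F = ≈-sym (identityˡ _)
  ∏-+ (suc m) n F = ≈-trans (∙-cong ≈-refl (∏-+ m n (F ∘ suc))) (≈-sym (assoc _ _ _))

  ∏-* : ∀ m n F → ∏ (m * n) F ≈ ∏ m (λ i → ∏ n (λ j → F (i * n + j)))
  ∏-* zero    n F = ≈-refl
  ∏-* (suc m) n F = begin
    ∏ (n + m * n) F
      ≈⟨ ∏-+ n (m * n) F ⟩
    ∏ n F ∙ ∏ (m * n) (λ k → F (n + k))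
      ≈⟨ ∙-cong ≈-refl (∏-* m n (λ k → F (n + k))) ⟩
    ∏ n F ∙ ∏ m (λ i → ∏ n (λ j → F (n + (i * n + j))))
      ≈⟨ ∙-cong ≈-refl (∏-cong m (λ i _ → ∏-cong n (λ j _ → reflexive (cong F (sym (ℕ.+-assoc n (i * n) j)))))) ⟩
    ∏ n F ∙ ∏ m (λ i → ∏ n (λ j → F (n + i * n + j)))
      ∎

  foldr≡∏ : ∀ n F → foldr _∙_ ε (applyUpTo F n) ≡ ∏ n F
  foldr≡∏ zero    F = refl
  foldr≡∏ (suc n) F = cong (F 0 ∙_) (foldr≡∏ n (F ∘ suc))

  ∏≡sum : ∀ n F → ∏ n F ≡ sum (λ (i : Fin n) → F (toℕ i))
  ∏≡sum zero    F = refl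
  ∏≡sum (suc n) F = cong (F 0 ∙_) (∏≡sum n (F ∘ suc))

  ∏-permute : ∀ {n} F G (π : Permutation n n) →
              (∀ i → F (toℕ i) ≈ G (toℕ (π ⟨$⟩ʳ i))) → ∏ n F ≈ ∏ n G
  ∏-permute {n} F G π F≈Gπ = begin
    ∏ n F                                 ≡⟨ ∏≡sum n F ⟩
    sum {n} (λ i → F (toℕ i))             ≈⟨ sum-cong-≋ F≈Gπ ⟩
    sum {n} (λ i → G (toℕ (π ⟨$⟩ʳ i)))    ≈⟨ sum-permute (λ i → G (toℕ i)) π ⟨
    sum {n} (λ i → G (toℕ i))             ≡⟨ ∏≡sum n G ⟨
    ∏ n G                                 ∎

open RangeProduct ℕ.+-0-commutativeMonoid public
  using () renaming (∏ to ∑; ∏-cong to ∑-cong; ∏-+ to ∑-+; ∏-* to ∑-*)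

∑-const : ∀ n k → ∑ n (λ _ → k) ≡ n * k
∑-const zero    k = refl
∑-const (suc n) k = cong (k +_) (∑-const n k)

∑-*ˡ : ∀ n k f → ∑ n (λ i → k * f i) ≡ k * ∑ n f
∑-*ˡ zero    k f = sym (ℕ.*-zeroʳ k)
∑-*ˡ (suc n) k f = trans (cong (k * f 0 +_) (∑-*ˡ n k (f ∘ suc))) (sym (ℕ.*-distribˡ-+ k (f 0) _))

∑-suc : ∀ n f → ∑ n (suc ∘ f) ≡ n + ∑ n f
∑-suc zero    f = refl
∑-suc (suc n) f = cong suc (begin
  f 0 + ∑ n (suc ∘ f ∘ suc)     ≡⟨ cong (f 0 +_) (∑-suc n (f ∘ suc)) ⟩
  f 0 + (n + ∑ n (f ∘ suc))     ≡⟨ ℕ.+-assoc (f 0) n _ ⟨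
  (f 0 + n) + ∑ n (f ∘ suc)     ≡⟨ cong (_+ ∑ n (f ∘ suc)) (ℕ.+-comm (f 0) n) ⟩
  (n + f 0) + ∑ n (f ∘ suc)     ≡⟨ ℕ.+-assoc n (f 0) _ ⟩
  n + (f 0 + ∑ n (f ∘ suc))     ∎)
  where open ≡-Reasoning

module PolynomialArithmetic {q : ℕ} (F : FiniteField q) where
  open FiniteField F
  open Poly F
  open IsCommutativeRing isCommRing using
    ( +-assoc; +-comm; +-identityˡ; +-identityʳ; -‿inverseˡ; -‿inverseʳ
    ; *-assoc; *-comm; *-identityˡ; distribˡ; distribʳ; zeroˡ; zeroʳ )

  coefficientRing : CommutativeRing 0ℓ 0ℓ
  coefficientRing = record { isCommutativeRing = isCommRing }

  open CommutativeRing coefficientRing using (ring; +-commutativeSemigroup)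
  open import Algebra.Properties.Ring ring using (-0#≈0#; -‿involutive; -‿+-comm; x∙y⁻¹≈ε⇒x≈y)
  open import Algebra.Properties.CommutativeSemigroup +-commutativeSemigroup
    using (interchange; x∙yz≈y∙xz)

  translation : Fin q → Permutation q q
  translation c = permutation (_+F (-F c)) (_+F c)
    (λ i → trans (+-assoc i c (-F c)) (trans (cong (i +F_) (-‿inverseʳ c)) (+-identityʳ i)))
    (λ i → trans (+-assoc i (-F c) c) (trans (cong (i +F_) (-‿inverseˡ c)) (+-identityʳ i)))

  ≢⇒-≢0 : ∀ {a b} → a ≢ b → a +F (-F b) ≢ 0F
  ≢⇒-≢0 a≢b a-b≡0 = a≢b (x∙y⁻¹≈ε⇒x≈y _ _ a-b≡0)

  0-[i-c]≡c-i : ∀ c i → 0F +F (-F (i +F (-F c))) ≡ c +F (-F i)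
  0-[i-c]≡c-i c i = begin
    0F +F (-F (i +F (-F c)))   ≡⟨ +-identityˡ _ ⟩
    -F (i +F (-F c))           ≡⟨ -‿+-comm i (-F c) ⟨
    (-F i) +F (-F (-F c))      ≡⟨ cong ((-F i) +F_) (-‿involutive c) ⟩
    (-F i) +F c                ≡⟨ +-comm (-F i) c ⟩
    c +F (-F i)                ∎
    where open ≡-Reasoning

  coeff : List (Fin q) → ℕ → Fin q
  coeff []      _       = 0F
  coeff (a ∷ x) zero    = a
  coeff (a ∷ x) (suc i) = coeff x i

  -- addL and mulL do not normalise, so their laws hold only up to _~_; on Normal lists
  -- _~_ is equality (Normal-~⇒≡).
  infix 4 _~_
  record _~_ (x y : List (Fin q)) : Set where
    constructor mk~
    field at : ∀ i → coeff x i ≡ coeff y i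
  open _~_ public

  ~-refl : ∀ {x} → x ~ x
  ~-refl = mk~ λ _ → refl

  ~-reflexive : ∀ {x y} → x ≡ y → x ~ y
  ~-reflexive refl = ~-refl

  ~-sym : ∀ {x y} → x ~ y → y ~ x
  ~-sym p = mk~ λ i → sym (at p i)

  ~-trans : ∀ {x y z} → x ~ y → y ~ z → x ~ z
  ~-trans p r = mk~ λ i → trans (at p i) (at r i)

  ~-setoid : Setoid 0ℓ 0ℓ
  ~-setoid = record
    { Carrier = List (Fin q) ; _≈_ = _~_
    ; isEquivalence = record { refl = ~-refl ; sym = ~-sym ; trans = ~-trans } }

  module ~-Reasoning = SetoidReasoning ~-setoid

  ∷-cong : ∀ {a b x y} → a ≡ b → x ~ y → a ∷ x ~ b ∷ y
  ∷-cong a≡b x~y = mk~ λ { zero → a≡b ; (suc i) → at x~y i }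

  drop₁-cong : ∀ {x y} → x ~ y → drop 1 x ~ drop 1 y
  drop₁-cong {[]}    {[]}    p = ~-refl
  drop₁-cong {[]}    {b ∷ y} p = mk~ (at p ∘ suc)
  drop₁-cong {a ∷ x} {[]}    p = mk~ (at p ∘ suc)
  drop₁-cong {a ∷ x} {b ∷ y} p = mk~ (at p ∘ suc)

  0∷[]~[] : 0F ∷ [] ~ []
  0∷[]~[] = mk~ λ { zero → refl ; (suc i) → refl }

  cons-0F-[] : cons 0F [] ≡ []
  cons-0F-[] with 0F ≟ᶠ 0F
  ... | yes _   = refl
  ... | no 0≢0 = ⊥-elim (0≢0 refl)

  cons-≢0-[] : ∀ {a} → a ≢ 0F → cons a [] ≡ a ∷ []
  cons-≢0-[] {a} a≢0 with a ≟ᶠ 0F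
  ... | yes a≡0 = ⊥-elim (a≢0 a≡0)
  ... | no _    = refl

  cons~∷ : ∀ a x → cons a x ~ a ∷ x
  cons~∷ a [] with a ≟ᶠ 0F
  ... | yes a≡0 = ~-sym (subst (λ b → b ∷ [] ~ []) (sym a≡0) 0∷[]~[])
  ... | no _    = ~-refl
  cons~∷ a (b ∷ x) = ~-refl

  norm~ : ∀ x → norm x ~ x
  norm~ []      = ~-refl
  norm~ (a ∷ x) = ~-trans (cons~∷ a (norm x)) (∷-cong refl (norm~ x))

  ~⇒norm≡ : ∀ {x y} → x ~ y → norm x ≡ norm y
  ~⇒norm≡ {[]}    {[]}    p = refl
  ~⇒norm≡ {[]}    {b ∷ y} p = begin
    []                 ≡⟨ cons-0F-[] ⟨
    cons 0F []         ≡⟨ cong₂ cons (at p 0) (~⇒norm≡ {[]} {y} (drop₁-cong p)) ⟩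
    cons b (norm y)    ∎
    where open ≡-Reasoning
  ~⇒norm≡ {a ∷ x} {[]}    p =
    trans (cong₂ cons (at p 0) (~⇒norm≡ {x} {[]} (drop₁-cong p))) cons-0F-[]
  ~⇒norm≡ {a ∷ x} {b ∷ y} p = cong₂ cons (at p 0) (~⇒norm≡ {x} {y} (drop₁-cong p))

  Normal⇒norm≡ : ∀ {x} → Normal x → norm x ≡ x
  Normal⇒norm≡ {[]}          _  = refl
  Normal⇒norm≡ {a ∷ []}      nx = cons-≢0-[] nx
  Normal⇒norm≡ {a ∷ b ∷ x}   nx = cong (cons a) (Normal⇒norm≡ {b ∷ x} nx)

  Normal-cons : ∀ a x → Normal x → Normal (cons a x)
  Normal-cons a [] _ with a ≟ᶠ 0F
  ... | yes _   = tt
  ... | no a≢0 = a≢0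
  Normal-cons a (b ∷ x) nx = nx

  Normal-norm : ∀ x → Normal (norm x)
  Normal-norm []      = tt
  Normal-norm (a ∷ x) = Normal-cons a (norm x) (Normal-norm x)

  Normal-∷⁻ : ∀ a x → Normal (a ∷ x) → Normal x
  Normal-∷⁻ a []      _  = tt
  Normal-∷⁻ a (b ∷ x) nx = nx

  Normal-~⇒≡ : ∀ {x y} → Normal x → Normal y → x ~ y → x ≡ y
  Normal-~⇒≡ nx ny x~y = trans (sym (Normal⇒norm≡ nx)) (trans (~⇒norm≡ x~y) (Normal⇒norm≡ ny))

  scale : Fin q → List (Fin q) → List (Fin q)
  scale a = map (a *F_)

  neg : List (Fin q) → List (Fin q)
  neg = map -F_

  coeff-addL : ∀ x y i → coeff (addL x y) i ≡ coeff x i +F coeff y i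
  coeff-addL []      y       i       = sym (+-identityˡ _)
  coeff-addL (a ∷ x) []      zero    = sym (+-identityʳ a)
  coeff-addL (a ∷ x) []      (suc i) = sym (+-identityʳ _)
  coeff-addL (a ∷ x) (b ∷ y) zero    = refl
  coeff-addL (a ∷ x) (b ∷ y) (suc i) = coeff-addL x y i

  coeff-neg : ∀ x i → coeff (neg x) i ≡ -F coeff x i
  coeff-neg []      i       = sym -0#≈0#
  coeff-neg (a ∷ x) zero    = refl
  coeff-neg (a ∷ x) (suc i) = coeff-neg x i

  coeff-scale : ∀ c x i → coeff (scale c x) i ≡ c *F coeff x i
  coeff-scale c []      i       = sym (zeroʳ c)
  coeff-scale c (a ∷ x) zero    = refl
  coeff-scale c (a ∷ x) (suc i) = coeff-scale c x i

  coeff-⊝ : ∀ x y i → coeff (x ⊝ y) i ≡ coeff x i +F (-F coeff y i)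
  coeff-⊝ x y i = begin
    coeff (x ⊝ y) i                      ≡⟨ at (norm~ (addL x (⊖ y))) i ⟩
    coeff (addL x (⊖ y)) i               ≡⟨ coeff-addL x (⊖ y) i ⟩
    coeff x i +F coeff (⊖ y) i           ≡⟨ cong (coeff x i +F_) (at (norm~ (neg y)) i) ⟩
    coeff x i +F coeff (neg y) i         ≡⟨ cong (coeff x i +F_) (coeff-neg y i) ⟩
    coeff x i +F (-F coeff y i)          ∎
    where open ≡-Reasoning

  addL-cong : ∀ {x x′ y y′} → x ~ x′ → y ~ y′ → addL x y ~ addL x′ y′
  addL-cong {x} {x′} {y} {y′} p r = mk~ λ i →
    trans (coeff-addL x y i) (trans (cong₂ _+F_ (at p i) (at r i)) (sym (coeff-addL x′ y′ i)))

  scale-cong : ∀ {a b x y} → a ≡ b → x ~ y → scale a x ~ scale b y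
  scale-cong {a} {b} {x} {y} a≡b p = mk~ λ i →
    trans (coeff-scale a x i) (trans (cong₂ _*F_ a≡b (at p i)) (sym (coeff-scale b y i)))

  addL-identityʳ : ∀ x → addL x [] ~ x
  addL-identityʳ x = mk~ λ i → trans (coeff-addL x [] i) (+-identityʳ _)

  addL-[]ˡ : ∀ {x} y → x ~ [] → addL x y ~ y
  addL-[]ˡ {x} y p = mk~ λ i →
    trans (coeff-addL x y i) (trans (cong (_+F coeff y i) (at p i)) (+-identityˡ _))

  addL-interchange : ∀ x y u v → addL (addL x y) (addL u v) ~ addL (addL x u) (addL y v)
  addL-interchange x y u v = mk~ λ i → begin
    coeff (addL (addL x y) (addL u v)) i
      ≡⟨ coeff-addL (addL x y) (addL u v) i ⟩
    coeff (addL x y) i +F coeff (addL u v) i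
      ≡⟨ cong₂ _+F_ (coeff-addL x y i) (coeff-addL u v i) ⟩
    (coeff x i +F coeff y i) +F (coeff u i +F coeff v i)
      ≡⟨ interchange _ _ _ _ ⟩
    (coeff x i +F coeff u i) +F (coeff y i +F coeff v i)
      ≡⟨ cong₂ _+F_ (coeff-addL x u i) (coeff-addL y v i) ⟨
    coeff (addL x u) i +F coeff (addL y v) i
      ≡⟨ coeff-addL (addL x u) (addL y v) i ⟨
    coeff (addL (addL x u) (addL y v)) i ∎
    where open ≡-Reasoning

  addL-swap : ∀ x y z → addL x (addL y z) ~ addL y (addL x z)
  addL-swap x y z = mk~ λ i → begin
    coeff (addL x (addL y z)) i                ≡⟨ coeff-addL x (addL y z) i ⟩
    coeff x i +F coeff (addL y z) i            ≡⟨ cong (coeff x i +F_) (coeff-addL y z i) ⟩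
    coeff x i +F (coeff y i +F coeff z i)      ≡⟨ x∙yz≈y∙xz _ _ _ ⟩
    coeff y i +F (coeff x i +F coeff z i)      ≡⟨ cong (coeff y i +F_) (coeff-addL x z i) ⟨
    coeff y i +F coeff (addL x z) i            ≡⟨ coeff-addL y (addL x z) i ⟨
    coeff (addL y (addL x z)) i                ∎
    where open ≡-Reasoning

  scale-addL : ∀ c x y → scale c (addL x y) ~ addL (scale c x) (scale c y)
  scale-addL c x y = mk~ λ i → begin
    coeff (scale c (addL x y)) i                     ≡⟨ coeff-scale c (addL x y) i ⟩
    c *F coeff (addL x y) i                          ≡⟨ cong (c *F_) (coeff-addL x y i) ⟩
    c *F (coeff x i +F coeff y i)                    ≡⟨ distribˡ c _ _ ⟩
    (c *F coeff x i) +F (c *F coeff y i)             ≡⟨ cong₂ _+F_ (coeff-scale c x i) (coeff-scale c y i) ⟨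
    coeff (scale c x) i +F coeff (scale c y) i       ≡⟨ coeff-addL (scale c x) (scale c y) i ⟨
    coeff (addL (scale c x) (scale c y)) i           ∎
    where open ≡-Reasoning

  scale-distribʳ : ∀ a b x → scale (a +F b) x ~ addL (scale a x) (scale b x)
  scale-distribʳ a b x = mk~ λ i → begin
    coeff (scale (a +F b) x) i                       ≡⟨ coeff-scale (a +F b) x i ⟩
    (a +F b) *F coeff x i                            ≡⟨ distribʳ _ a b ⟩
    (a *F coeff x i) +F (b *F coeff x i)             ≡⟨ cong₂ _+F_ (coeff-scale a x i) (coeff-scale b x i) ⟨
    coeff (scale a x) i +F coeff (scale b x) i       ≡⟨ coeff-addL (scale a x) (scale b x) i ⟨
    coeff (addL (scale a x) (scale b x)) i           ∎
    where open ≡-Reasoning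

  scale-scale : ∀ a b x → scale a (scale b x) ~ scale (a *F b) x
  scale-scale a b x = mk~ λ i → begin
    coeff (scale a (scale b x)) i     ≡⟨ coeff-scale a (scale b x) i ⟩
    a *F coeff (scale b x) i          ≡⟨ cong (a *F_) (coeff-scale b x i) ⟩
    a *F (b *F coeff x i)             ≡⟨ *-assoc a b _ ⟨
    (a *F b) *F coeff x i             ≡⟨ coeff-scale (a *F b) x i ⟨
    coeff (scale (a *F b) x) i        ∎
    where open ≡-Reasoning

  scale-zeroˡ : ∀ {a} x → a ≡ 0F → scale a x ~ []
  scale-zeroˡ {a} x a≡0 = mk~ λ i →
    trans (coeff-scale a x i) (trans (cong (_*F coeff x i) a≡0) (zeroˡ _))

  scale-identityˡ : ∀ x → scale 1F x ~ x
  scale-identityˡ x = mk~ λ i → trans (coeff-scale 1F x i) (*-identityˡ _)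

  mulL-0∷ : ∀ x y → mulL (0F ∷ x) y ~ 0F ∷ mulL x y
  mulL-0∷ x y = addL-[]ˡ (0F ∷ mulL x y) (scale-zeroˡ y refl)

  mulL-zeroˡ : ∀ {x} y → x ~ [] → mulL x y ~ []
  mulL-zeroˡ {[]}    y p = ~-refl
  mulL-zeroˡ {a ∷ x} y p = begin
    addL (scale a y) (0F ∷ mulL x y)   ≈⟨ addL-[]ˡ (0F ∷ mulL x y) (scale-zeroˡ y (at p 0)) ⟩
    0F ∷ mulL x y                      ≈⟨ ∷-cong refl (mulL-zeroˡ {x} y (drop₁-cong p)) ⟩
    0F ∷ []                            ≈⟨ 0∷[]~[] ⟩
    []                                 ∎
    where open ~-Reasoning

  mulL-zeroʳ : ∀ x → mulL x [] ~ []
  mulL-zeroʳ []      = ~-refl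
  mulL-zeroʳ (a ∷ x) = ~-trans (∷-cong refl (mulL-zeroʳ x)) 0∷[]~[]

  mulL-congˡ : ∀ {x x′} y → x ~ x′ → mulL x y ~ mulL x′ y
  mulL-congˡ {[]}    {x′}     y p = ~-sym (mulL-zeroˡ y (~-sym p))
  mulL-congˡ {a ∷ x} {[]}     y p = mulL-zeroˡ y p
  mulL-congˡ {a ∷ x} {b ∷ x′} y p =
    addL-cong (scale-cong (at p 0) ~-refl) (∷-cong refl (mulL-congˡ {x} {x′} y (drop₁-cong p)))

  mulL-congʳ : ∀ x {y y′} → y ~ y′ → mulL x y ~ mulL x y′
  mulL-congʳ []      p = ~-refl
  mulL-congʳ (a ∷ x) p = addL-cong (scale-cong refl p) (∷-cong refl (mulL-congʳ x p))

  mulL-distribʳ : ∀ x y z → mulL (addL x y) z ~ addL (mulL x z) (mulL y z)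
  mulL-distribʳ []      y       z = ~-refl
  mulL-distribʳ (a ∷ x) []      z = ~-sym (addL-identityʳ _)
  mulL-distribʳ (a ∷ x) (b ∷ y) z = begin
    addL (scale (a +F b) z) (0F ∷ mulL (addL x y) z)
      ≈⟨ addL-cong (scale-distribʳ a b z) (∷-cong (sym (+-identityˡ 0F)) (mulL-distribʳ x y z)) ⟩
    addL (addL (scale a z) (scale b z)) (addL (0F ∷ mulL x z) (0F ∷ mulL y z))
      ≈⟨ addL-interchange (scale a z) (scale b z) (0F ∷ mulL x z) (0F ∷ mulL y z) ⟩
    addL (addL (scale a z) (0F ∷ mulL x z)) (addL (scale b z) (0F ∷ mulL y z))
      ∎
    where open ~-Reasoning

  mulL-scaleˡ : ∀ c x y → mulL (scale c x) y ~ scale c (mulL x y)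
  mulL-scaleˡ c []      y = ~-refl
  mulL-scaleˡ c (a ∷ x) y = begin
    addL (scale (c *F a) y) (0F ∷ mulL (scale c x) y)
      ≈⟨ addL-cong (~-sym (scale-scale c a y)) (∷-cong (sym (zeroʳ c)) (mulL-scaleˡ c x y)) ⟩
    addL (scale c (scale a y)) (scale c (0F ∷ mulL x y))
      ≈⟨ scale-addL c (scale a y) (0F ∷ mulL x y) ⟨
    scale c (addL (scale a y) (0F ∷ mulL x y))
      ∎
    where open ~-Reasoning

  mulL-assoc : ∀ x y z → mulL (mulL x y) z ~ mulL x (mulL y z)
  mulL-assoc []      y z = ~-refl
  mulL-assoc (a ∷ x) y z = begin
    mulL (addL (scale a y) (0F ∷ mulL x y)) z
      ≈⟨ mulL-distribʳ (scale a y) (0F ∷ mulL x y) z ⟩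
    addL (mulL (scale a y) z) (mulL (0F ∷ mulL x y) z)
      ≈⟨ addL-cong (mulL-scaleˡ a y z) (~-trans (mulL-0∷ (mulL x y) z) (∷-cong refl (mulL-assoc x y z))) ⟩
    addL (scale a (mulL y z)) (0F ∷ mulL x (mulL y z))
      ∎
    where open ~-Reasoning

  mulL-∷ʳ : ∀ x b y → mulL x (b ∷ y) ~ addL (scale b x) (0F ∷ mulL x y)
  mulL-∷ʳ []      b y = ~-sym 0∷[]~[]
  mulL-∷ʳ (a ∷ x) b y = ∷-cong (cong (_+F 0F) (*-comm a b))
    (~-trans (addL-cong ~-refl (mulL-∷ʳ x b y)) (addL-swap (scale a y) (scale b x) (0F ∷ mulL x y)))

  mulL-comm : ∀ x y → mulL x y ~ mulL y x
  mulL-comm []      y = ~-sym (mulL-zeroʳ y)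
  mulL-comm (a ∷ x) y = ~-trans (addL-cong ~-refl (∷-cong refl (mulL-comm x y))) (~-sym (mulL-∷ʳ y a x))

  mulL-identityˡ : ∀ x → mulL one x ~ x
  mulL-identityˡ x = ~-trans (addL-cong (scale-identityˡ x) 0∷[]~[]) (addL-identityʳ x)

  mulL-tPoly : ∀ x → mulL tPoly x ~ 0F ∷ x
  mulL-tPoly x = ~-trans (mulL-0∷ one x) (∷-cong refl (mulL-identityˡ x))

  ⊗~mulL : ∀ x y → x ⊗ y ~ mulL x y
  ⊗~mulL x y = norm~ (mulL x y)

  ⊗-cong : ∀ {x x′ y y′} → x ~ x′ → y ~ y′ → x ⊗ y ~ x′ ⊗ y′
  ⊗-cong {x} {x′} {y} {y′} p r = begin
    x ⊗ y         ≈⟨ ⊗~mulL x y ⟩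
    mulL x y      ≈⟨ mulL-congˡ y p ⟩
    mulL x′ y     ≈⟨ mulL-congʳ x′ r ⟩
    mulL x′ y′    ≈⟨ ⊗~mulL x′ y′ ⟨
    x′ ⊗ y′       ∎
    where open ~-Reasoning

  ⊗-assoc : ∀ x y z → (x ⊗ y) ⊗ z ~ x ⊗ (y ⊗ z)
  ⊗-assoc x y z = begin
    (x ⊗ y) ⊗ z          ≈⟨ ⊗~mulL (x ⊗ y) z ⟩
    mulL (x ⊗ y) z       ≈⟨ mulL-congˡ z (⊗~mulL x y) ⟩
    mulL (mulL x y) z    ≈⟨ mulL-assoc x y z ⟩
    mulL x (mulL y z)    ≈⟨ mulL-congʳ x (⊗~mulL y z) ⟨
    mulL x (y ⊗ z)       ≈⟨ ⊗~mulL x (y ⊗ z) ⟨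
    x ⊗ (y ⊗ z)          ∎
    where open ~-Reasoning

  ⊗-comm : ∀ x y → x ⊗ y ~ y ⊗ x
  ⊗-comm x y = ~-trans (⊗~mulL x y) (~-trans (mulL-comm x y) (~-sym (⊗~mulL y x)))

  ⊗-identityˡ : ∀ x → one ⊗ x ~ x
  ⊗-identityˡ x = ~-trans (⊗~mulL one x) (mulL-identityˡ x)

  ⊗-identityʳ : ∀ x → x ⊗ one ~ x
  ⊗-identityʳ x = ~-trans (⊗-comm x one) (⊗-identityˡ x)

  ⊗-normʳ : ∀ x y → x ⊗ norm y ≡ x ⊗ y
  ⊗-normʳ x y = ~⇒norm≡ (mulL-congʳ x (norm~ y))

  ⊗-commutativeMonoid : CommutativeMonoid 0ℓ 0ℓ
  ⊗-commutativeMonoid = record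
    { Carrier = List (Fin q) ; _≈_ = _~_ ; _∙_ = _⊗_ ; ε = one
    ; isCommutativeMonoid = record
      { isMonoid = record
        { isSemigroup = record
          { isMagma = record { isEquivalence = Setoid.isEquivalence ~-setoid ; ∙-cong = ⊗-cong }
          ; assoc = ⊗-assoc }
        ; identity = ⊗-identityˡ , ⊗-identityʳ }
      ; comm = ⊗-comm } }

  open RangeProduct ⊗-commutativeMonoid public using (∏; foldr≡∏; ∏-cong; ∏-+; ∏-*; ∏-permute)

  Normal-one : Normal one
  Normal-one 1≡0 = 0≢1 (sym 1≡0)

  Normal-⊗ : ∀ x y → Normal (x ⊗ y)
  Normal-⊗ x y = Normal-norm (mulL x y)

  Normal-⊝ : ∀ x y → Normal (x ⊝ y)
  Normal-⊝ x y = Normal-norm (addL x (⊖ y))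

  ⊝-cong : ∀ {x x′ y y′} → x ~ x′ → y ~ y′ → x ⊝ y ≡ x′ ⊝ y′
  ⊝-cong {x} {x′} {y} {y′} p r = Normal-~⇒≡ (Normal-⊝ x y) (Normal-⊝ x′ y′) (mk~ λ i →
    trans (coeff-⊝ x y i) (trans (cong₂ (λ a b → a +F (-F b)) (at p i) (at r i)) (sym (coeff-⊝ x′ y′ i))))

  Normal-∏ : ∀ n G → Normal (∏ n G)
  Normal-∏ zero    G = Normal-one
  Normal-∏ (suc n) G = Normal-⊗ (G 0) (∏ n (G ∘ suc))

  ⊝≡[]⇒~ : ∀ x y → x ⊝ y ≡ [] → x ~ y
  ⊝≡[]⇒~ x y x⊝y≡[] = mk~ λ i → x∙y⁻¹≈ε⇒x≈y _ _
    (trans (sym (coeff-⊝ x y i)) (cong (λ z → coeff z i) x⊝y≡[]))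

  ~⇒⊝≡[] : ∀ {x y} → x ~ y → x ⊝ y ≡ []
  ~⇒⊝≡[] {x} {y} p = Normal-~⇒≡ (Normal-⊝ x y) tt (mk~ λ i →
    trans (coeff-⊝ x y i) (trans (cong (_+F (-F coeff y i)) (at p i)) (-‿inverseʳ _)))

  ∷⊝∷ : ∀ c x d y → (c ∷ x) ⊝ (d ∷ y) ≡ cons (c +F (-F d)) (x ⊝ y)
  ∷⊝∷ c x d y = Normal-~⇒≡ (Normal-⊝ (c ∷ x) (d ∷ y)) (Normal-cons _ (x ⊝ y) (Normal-⊝ x y))
    (~-trans (mk~ λ { zero    → coeff-⊝ (c ∷ x) (d ∷ y) 0
                    ; (suc i) → trans (coeff-⊝ (c ∷ x) (d ∷ y) (suc i)) (sym (coeff-⊝ x y i)) })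
             (~-sym (cons~∷ _ (x ⊝ y))))

  deg : List (Fin q) → ℕ
  deg x = length x ∸ 1

  coeff-≥length : ∀ x {i} → length x ≤ i → coeff x i ≡ 0F
  coeff-≥length []      _          = refl
  coeff-≥length (a ∷ x) (s≤s x≤i) = coeff-≥length x x≤i

  coeff≢0⇒<length : ∀ x {i} → coeff x i ≢ 0F → i < length x
  coeff≢0⇒<length x {i} xᵢ≢0 with i ℕ.<? length x
  ... | yes i<len = i<len
  ... | no  i≮len = ⊥-elim (xᵢ≢0 (coeff-≥length x (ℕ.≮⇒≥ i≮len)))

  lead≢0 : ∀ a x → Normal (a ∷ x) → coeff (a ∷ x) (length x) ≢ 0F
  lead≢0 a []      n = n
  lead≢0 a (b ∷ x) n = lead≢0 b x n

  Normal-length-≤ : ∀ {x} k → Normal x → (∀ i → k ≤ i → coeff x i ≡ 0F) → length x ≤ k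
  Normal-length-≤ {[]}    k _  _      = z≤n
  Normal-length-≤ {a ∷ x} k nx vanish with length x ℕ.<? k
  ... | yes len<k = len<k
  ... | no  len≮k = ⊥-elim (lead≢0 a x nx (vanish (length x) (ℕ.≮⇒≥ len≮k)))

  coeff-mulL-high : ∀ x y i → length x + length y ≤ suc i → coeff (mulL x y) i ≡ 0F
  coeff-mulL-high []      y i _         = refl
  coeff-mulL-high (a ∷ x) y i (s≤s le) = begin
    coeff (addL (scale a y) (0F ∷ mulL x y)) i          ≡⟨ coeff-addL (scale a y) (0F ∷ mulL x y) i ⟩
    coeff (scale a y) i +F coeff (0F ∷ mulL x y) i      ≡⟨ cong₂ _+F_ scaled (shifted i le) ⟩
    0F +F 0F                                            ≡⟨ +-identityˡ 0F ⟩
    0F                                                  ∎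
    where
    open ≡-Reasoning
    scaled : coeff (scale a y) i ≡ 0F
    scaled = trans (coeff-scale a y i)
      (trans (cong (a *F_) (coeff-≥length y (ℕ.≤-trans (ℕ.m≤n+m (length y) (length x)) le))) (zeroʳ a))
    shifted : ∀ i → length x + length y ≤ i → coeff (0F ∷ mulL x y) i ≡ 0F
    shifted zero    _  = refl
    shifted (suc j) le = coeff-mulL-high x y j le

  coeff-mulL-top : ∀ a x b y → coeff (mulL (a ∷ x) (b ∷ y)) (length x + length y)
                               ≡ coeff (a ∷ x) (length x) *F coeff (b ∷ y) (length y)
  coeff-mulL-top a []      b y = begin
    coeff (addL (scale a (b ∷ y)) (0F ∷ [])) (length y)
      ≡⟨ coeff-addL (scale a (b ∷ y)) (0F ∷ []) (length y) ⟩
    coeff (scale a (b ∷ y)) (length y) +F coeff (0F ∷ []) (length y)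
      ≡⟨ cong₂ _+F_ (coeff-scale a (b ∷ y) (length y)) (at 0∷[]~[] (length y)) ⟩
    (a *F coeff (b ∷ y) (length y)) +F 0F
      ≡⟨ +-identityʳ _ ⟩
    a *F coeff (b ∷ y) (length y)
      ∎
    where open ≡-Reasoning
  coeff-mulL-top a (c ∷ x) b y = begin
    coeff (addL (scale a (b ∷ y)) (0F ∷ mulL (c ∷ x) (b ∷ y))) (suc n)
      ≡⟨ coeff-addL (scale a (b ∷ y)) (0F ∷ mulL (c ∷ x) (b ∷ y)) (suc n) ⟩
    coeff (scale a y) n +F coeff (mulL (c ∷ x) (b ∷ y)) n
      ≡⟨ cong₂ _+F_ scaled (coeff-mulL-top c x b y) ⟩
    0F +F (coeff (c ∷ x) (length x) *F coeff (b ∷ y) (length y))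
      ≡⟨ +-identityˡ _ ⟩
    coeff (c ∷ x) (length x) *F coeff (b ∷ y) (length y)
      ∎
    where
    open ≡-Reasoning
    n = length x + length y
    scaled : coeff (scale a y) n ≡ 0F
    scaled = trans (coeff-scale a y n)
      (trans (cong (a *F_) (coeff-≥length y (ℕ.m≤n+m (length y) (length x)))) (zeroʳ a))

  *-≢0 : ∀ {a b} → a ≢ 0F → b ≢ 0F → a *F b ≢ 0F
  *-≢0 {a} {b} a≢0 b≢0 ab≡0 with inverse a a≢0
  ... | a⁻¹ , aa⁻¹≡1 = b≢0 (begin
    b                  ≡⟨ *-identityˡ b ⟨
    1F *F b            ≡⟨ cong (_*F b) (trans (*-comm a⁻¹ a) aa⁻¹≡1) ⟨
    (a⁻¹ *F a) *F b    ≡⟨ *-assoc a⁻¹ a b ⟩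
    a⁻¹ *F (a *F b)    ≡⟨ cong (a⁻¹ *F_) ab≡0 ⟩
    a⁻¹ *F 0F          ≡⟨ zeroʳ a⁻¹ ⟩
    0F                 ∎)
    where open ≡-Reasoning

  length-⊗ : ∀ a x b y → Normal (a ∷ x) → Normal (b ∷ y) →
             length ((a ∷ x) ⊗ (b ∷ y)) ≡ suc (length x + length y)
  length-⊗ a x b y nx ny = ℕ.≤-antisym upper lower
    where
    product = mulL (a ∷ x) (b ∷ y)
    upper : length (norm product) ≤ suc (length x + length y)
    upper = Normal-length-≤ {norm product} _ (Normal-norm product) λ i le →
      trans (at (norm~ product) i) (coeff-mulL-high (a ∷ x) (b ∷ y) i
        (subst (_≤ suc i) (cong suc (sym (ℕ.+-suc (length x) (length y)))) (s≤s le)))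
    lower : length x + length y < length (norm product)
    lower = coeff≢0⇒<length (norm product) λ top≡0 →
      *-≢0 (lead≢0 a x nx) (lead≢0 b y ny)
           (trans (sym (coeff-mulL-top a x b y)) (trans (sym (at (norm~ product) _)) top≡0))

  deg-⊗ : ∀ {x y} → Normal x → Normal y → x ≢ [] → y ≢ [] →
          (x ⊗ y ≢ []) × (deg (x ⊗ y) ≡ deg x + deg y)
  deg-⊗ {[]}    {y}     _  _  x≢[] _    = ⊥-elim (x≢[] refl)
  deg-⊗ {a ∷ x} {[]}    _  _  _    y≢[] = ⊥-elim (y≢[] refl)
  deg-⊗ {a ∷ x} {b ∷ y} nx ny _    _    =
    (λ xy≡[] → ℕ.1+n≢0 (trans (sym (length-⊗ a x b y nx ny)) (cong length xy≡[])))
    , cong (_∸ 1) (length-⊗ a x b y nx ny)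

  deg-∏ : ∀ n G → (∀ i → Normal (G i)) → (∀ i → i < n → G i ≢ []) →
          (∏ n G ≢ []) × (deg (∏ n G) ≡ ∑ n (deg ∘ G))
  deg-∏ zero    G _      _        = (λ ()) , refl
  deg-∏ (suc n) G normal nonzero with deg-∏ n (G ∘ suc) (normal ∘ suc) (λ i i<n → nonzero (suc i) (s≤s i<n))
  ... | ∏≢[] , deg∏ with deg-⊗ (normal 0) (Normal-∏ n (G ∘ suc)) (nonzero 0 (s≤s z≤n)) ∏≢[]
  ... | G0∏≢[] , degG0∏ = G0∏≢[] , trans degG0∏ (cong (deg (G 0) +_) deg∏)

  Unit : List (Fin q) → Set
  Unit u = ∃ λ v → u ⊗ v ~ one

  Unit-⊗ : ∀ u w → Unit u → Unit w → Unit (u ⊗ w)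
  Unit-⊗ u w (v , uv~1) (z , wz~1) = v ⊗ z , (begin
    (u ⊗ w) ⊗ (v ⊗ z)     ≈⟨ ⊗-assoc u w (v ⊗ z) ⟩
    u ⊗ (w ⊗ (v ⊗ z))     ≈⟨ ⊗-cong (~-refl {u}) (~-sym (⊗-assoc w v z)) ⟩
    u ⊗ ((w ⊗ v) ⊗ z)     ≈⟨ ⊗-cong (~-refl {u}) (⊗-cong (⊗-comm w v) (~-refl {z})) ⟩
    u ⊗ ((v ⊗ w) ⊗ z)     ≈⟨ ⊗-cong (~-refl {u}) (⊗-assoc v w z) ⟩
    u ⊗ (v ⊗ (w ⊗ z))     ≈⟨ ⊗-assoc u v (w ⊗ z) ⟨
    (u ⊗ v) ⊗ (w ⊗ z)     ≈⟨ ⊗-cong uv~1 wz~1 ⟩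
    one ⊗ one             ≈⟨ ⊗-identityˡ one ⟩
    one                   ∎)
    where open ~-Reasoning

  Unit-constant : ∀ {c} → c ≢ 0F → Unit (c ∷ [])
  Unit-constant {c} c≢0 with inverse c c≢0
  ... | c⁻¹ , cc⁻¹≡1 =
    c⁻¹ ∷ [] , ~-trans (⊗~mulL (c ∷ []) (c⁻¹ ∷ [])) (∷-cong (trans (+-identityʳ _) cc⁻¹≡1) ~-refl)

  Unit-∏ : ∀ n G → (∀ i → i < n → Unit (G i)) → Unit (∏ n G)
  Unit-∏ zero    G _     = one , ⊗-identityˡ one
  Unit-∏ (suc n) G units = Unit-⊗ (G 0) (∏ n (G ∘ suc))
    (units 0 (s≤s z≤n)) (Unit-∏ n (G ∘ suc) (λ i i<n → units (suc i) (s≤s i<n)))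

  ∣P-cancel-Unit : ∀ {f z y u} → Normal y → Unit u → z ~ y ⊗ u → f ∣P z → f ∣P y
  ∣P-cancel-Unit {f} {z} {y} {u} ny (v , uv~1) z~yu (h , fh≡z) =
    h ⊗ v , Normal-~⇒≡ (Normal-⊗ f (h ⊗ v)) ny (begin
    f ⊗ (h ⊗ v)       ≈⟨ ⊗-assoc f h v ⟨
    (f ⊗ h) ⊗ v       ≈⟨ ⊗-cong (~-reflexive fh≡z) (~-refl {v}) ⟩
    z ⊗ v             ≈⟨ ⊗-cong z~yu (~-refl {v}) ⟩
    (y ⊗ u) ⊗ v       ≈⟨ ⊗-assoc y u v ⟩
    y ⊗ (u ⊗ v)       ≈⟨ ⊗-cong (~-refl {y}) uv~1 ⟩
    y ⊗ one           ≈⟨ ⊗-identityʳ y ⟩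
    y                 ∎)
    where open ~-Reasoning

  ∣P⇒deg≤ : ∀ {x y} → Normal x → x ≢ [] → y ≢ [] → x ∣P y → deg x ≤ deg y
  ∣P⇒deg≤ {x} {y} nx x≢[] y≢[] (k , xk≡y) with norm k in normk≡ | Normal-norm k
  ... | [] | _ = ⊥-elim (y≢[] (begin
    y                ≡⟨ xk≡y ⟨
    x ⊗ k            ≡⟨ ⊗-normʳ x k ⟨
    x ⊗ norm k       ≡⟨ cong (x ⊗_) normk≡ ⟩
    x ⊗ []           ≡⟨ Normal-~⇒≡ (Normal-⊗ x []) tt (~-trans (⊗~mulL x []) (mulL-zeroʳ x)) ⟩
    []               ∎))
    where open ≡-Reasoning
  ... | z ∷ zs | nz with deg-⊗ nx nz x≢[] (λ ())
  ...   | _ , deg-x⊗z = ℕ.≤-trans (ℕ.m≤m+n (deg x) (deg (z ∷ zs))) (ℕ.≤-reflexive (begin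
    deg x + deg (z ∷ zs)   ≡⟨ deg-x⊗z ⟨
    deg (x ⊗ (z ∷ zs))     ≡⟨ cong (λ w → deg (x ⊗ w)) normk≡ ⟨
    deg (x ⊗ norm k)       ≡⟨ cong deg (trans (⊗-normʳ x k) xk≡y) ⟩
    deg y                  ∎))
    where open ≡-Reasoning

  coeff0≡0⇒tPoly∣P : ∀ {g} → Normal g → coeff g 0 ≡ 0F → tPoly ∣P g
  coeff0≡0⇒tPoly∣P {[]}    _  _    =
    [] , Normal-~⇒≡ (Normal-⊗ tPoly []) tt (~-trans (⊗~mulL tPoly []) (mulL-zeroʳ tPoly))
  coeff0≡0⇒tPoly∣P {c ∷ x} ng c≡0 = x , Normal-~⇒≡ (Normal-⊗ tPoly x) ng
    (~-trans (⊗~mulL tPoly x) (~-trans (mulL-tPoly x) (∷-cong (sym c≡0) ~-refl)))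


module Factorials {p : ℕ} (F : FiniteField (suc (suc p))) where
  open FiniteField F
  open Poly F
  open PolynomialArithmetic F

  q : ℕ
  q = suc (suc p)

  1<q : 1 < q
  1<q = s≤s (s≤s z≤n)

  digitsFuel-enough : ∀ k k′ n → n ≤ k → n ≤ k′ → digitsFuel q k n ≡ digitsFuel q k′ n
  digitsFuel-enough zero    zero     zero    _        _        = refl
  digitsFuel-enough zero    (suc k′) zero    _        _        = refl
  digitsFuel-enough (suc k) zero     zero    _        _        = refl
  digitsFuel-enough (suc k) (suc k′) zero    _        _        = refl
  digitsFuel-enough (suc k) (suc k′) (suc m) (s≤s m≤k) (s≤s m≤k′) =
    cong (_ ∷_) (digitsFuel-enough k k′ (suc m / q) (quotient≤ m≤k) (quotient≤ m≤k′))
    where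
    quotient≤ : ∀ {j} → m ≤ j → suc m / q ≤ j
    quotient≤ m≤j = ℕ.≤-trans (ℕ.<⇒≤pred (m/n<m (suc m) q 1<q)) m≤j

  digit-/ : ∀ A (c : Fin q) → (A * q + toℕ c) / q ≡ A
  digit-/ A c = begin
    (A * q + toℕ c) / q          ≡⟨ +-distrib-/-∣ˡ (toℕ c) (divides-refl A) ⟩
    A * q / q + toℕ c / q        ≡⟨ cong₂ _+_ (m*n/n≡m A q) (m<n⇒m/n≡0 (toℕ<n c)) ⟩
    A + 0                        ≡⟨ ℕ.+-identityʳ A ⟩
    A                            ∎
    where open ≡-Reasoning

  digit-% : ∀ A (c : Fin q) → (A * q + toℕ c) % q ≡ toℕ c
  digit-% A c = trans (%-remove-+ˡ (toℕ c) (divides-refl A)) (m<n⇒m%n≡m (toℕ<n c))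

  decode-digit : ∀ A (c : Fin q) → decode (A * q + toℕ c) ~ c ∷ decode A
  decode-digit A c with A * q + toℕ c in N≡
  ... | zero = mk~ λ { zero    → sym (toℕ-injective (trans c≡0 (sym zero-index)))
                     ; (suc i) → cong (λ M → coeff (decode M) i) (sym A≡0) }
    where
    c≡0 : toℕ c ≡ 0
    c≡0 = ℕ.m+n≡0⇒n≡0 (A * q) N≡
    A≡0 : A ≡ 0
    A≡0 = ℕ.m*n≡0⇒m≡0 A q (ℕ.m+n≡0⇒m≡0 (A * q) N≡)
  ... | suc m = ∷-cong low (~-reflexive high)
    where
    low : fromℕ< (m%n<n (suc m) q) ≡ c
    low = toℕ-injective (trans (toℕ-fromℕ< _) (trans (cong (_% q) (sym N≡)) (digit-% A c)))
    quotient≡ : suc m / q ≡ A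
    quotient≡ = trans (cong (_/ q) (sym N≡)) (digit-/ A c)
    high : digitsFuel q m (suc m / q) ≡ decode A
    high = trans (cong (digitsFuel q m) quotient≡)
      (digitsFuel-enough m A A (subst (_≤ m) quotient≡ (ℕ.<⇒≤pred (m/n<m (suc m) q 1<q))) ℕ.≤-refl)

  decode-digit< : ∀ A {d} (d<q : d < q) → decode (A * q + d) ~ fromℕ< d<q ∷ decode A
  decode-digit< A d<q =
    subst (λ d → decode (A * q + d) ~ fromℕ< d<q ∷ decode A) (toℕ-fromℕ< d<q) (decode-digit A (fromℕ< d<q))

  lowDigit : ℕ → Fin q
  lowDigit N = fromℕ< (m%n<n N q)

  /-lowDigit : ∀ N → N / q * q + toℕ (lowDigit N) ≡ N
  /-lowDigit N = begin
    N / q * q + toℕ (lowDigit N)   ≡⟨ cong (N / q * q +_) (toℕ-fromℕ< _) ⟩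
    N / q * q + N % q              ≡⟨ ℕ.+-comm (N / q * q) (N % q) ⟩
    N % q + N / q * q              ≡⟨ m≡m%n+[m/n]*n N q ⟨
    N                              ∎
    where open ≡-Reasoning

  δ-∷ : ∀ a x → δ (a ∷ x) ≡ δ x * q + toℕ a
  δ-∷ a x = trans (ℕ.+-comm (toℕ a) (q * δ x)) (cong (_+ toℕ a) (ℕ.*-comm q (δ x)))

  δ-cons : ∀ a x → δ (cons a x) ≡ δ (a ∷ x)
  δ-cons a [] with a ≟ᶠ 0F
  ... | yes refl = sym (cong₂ _+_ zero-index (ℕ.*-zeroʳ q))
  ... | no  _    = refl
  δ-cons a (b ∷ x) = refl

  δ-norm : ∀ x → δ (norm x) ≡ δ x
  δ-norm []      = refl
  δ-norm (a ∷ x) = trans (δ-cons a (norm x)) (cong (λ d → toℕ a + q * d) (δ-norm x))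

  δ-cong : ∀ {x y} → x ~ y → δ x ≡ δ y
  δ-cong {x} {y} x~y = trans (sym (δ-norm x)) (trans (cong δ (~⇒norm≡ x~y)) (δ-norm y))

  δ-0∷ : ∀ x → δ (0F ∷ x) ≡ δ x * q
  δ-0∷ x = trans (δ-∷ 0F x) (trans (cong (δ x * q +_) zero-index) (ℕ.+-identityʳ _))

  decode-split : ∀ N → decode N ~ lowDigit N ∷ decode (N / q)
  decode-split N = subst (λ M → decode M ~ lowDigit N ∷ decode (N / q)) (/-lowDigit N)
                         (decode-digit (N / q) (lowDigit N))

  δ-decode : ∀ N → δ (decode N) ≡ N
  δ-decode = <-rec _ go
    where
    open ≡-Reasoning
    go : ∀ N → (∀ {M} → M < N → δ (decode M) ≡ M) → δ (decode N) ≡ N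
    go zero          _   = refl
    go N@(suc _) rec = begin
      δ (decode N)                               ≡⟨ δ-cong (decode-split N) ⟩
      δ (lowDigit N ∷ decode (N / q))            ≡⟨ δ-∷ (lowDigit N) (decode (N / q)) ⟩
      δ (decode (N / q)) * q + toℕ (lowDigit N)  ≡⟨ cong (λ M → M * q + toℕ (lowDigit N)) (rec (m/n<m N q 1<q)) ⟩
      N / q * q + toℕ (lowDigit N)               ≡⟨ /-lowDigit N ⟩
      N                                          ∎

  ~decode-δ : ∀ x → x ~ decode (δ x)
  ~decode-δ []      = ~-refl
  ~decode-δ (a ∷ x) = subst (λ N → a ∷ x ~ decode N) (sym (δ-∷ a x))
    (~-trans (∷-cong refl (~decode-δ x)) (~-sym (decode-digit (δ x) a)))

  ⊝-decode≢[] : ∀ x {n} → n ≢ δ x → x ⊝ decode n ≢ []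
  ⊝-decode≢[] x {n} n≢δx x⊝n≡[] =
    n≢δx (trans (sym (δ-decode n)) (sym (δ-cong (⊝≡[]⇒~ x (decode n) x⊝n≡[]))))

  -- The degree of a factorial

  fact≡∏ : ∀ g → fact g ≡ ∏ (δ g) (λ n → g ⊝ decode n)
  fact≡∏ g = trans (cong (foldr _⊗_ one) (map-upTo (λ n → g ⊝ decode n) (δ g))) (foldr≡∏ (δ g) _)

  Normal-fact : ∀ g → Normal (fact g)
  Normal-fact g = subst Normal (sym (fact≡∏ g)) (Normal-∏ (δ g) _)

  degDiff : ℕ → ℕ → ℕ
  degDiff N k = deg (decode N ⊝ decode k)

  degFact : ℕ → ℕ
  degFact N = ∑ N (degDiff N)

  deg-cons-[] : ∀ e → deg (cons e []) ≡ 0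
  deg-cons-[] e with e ≟ᶠ 0F
  ... | yes _ = refl
  ... | no  _ = refl

  deg-cons-≢[] : ∀ e {z} → z ≢ [] → deg (cons e z) ≡ suc (deg z)
  deg-cons-≢[] e {[]}    z≢[] = ⊥-elim (z≢[] refl)
  deg-cons-≢[] e {z ∷ x} _    = refl

  decode-digits-⊝ : ∀ A B {c d} (c<q : c < q) (d<q : d < q) →
    decode (A * q + c) ⊝ decode (B * q + d) ≡ cons (fromℕ< c<q +F (-F fromℕ< d<q)) (decode A ⊝ decode B)
  decode-digits-⊝ A B {c} {d} c<q d<q =
    trans (⊝-cong (decode-digit< A c<q) (decode-digit< B d<q))
          (∷⊝∷ _ (decode A) _ (decode B))

  degDiff-digits-≢ : ∀ A B {c d} → c < q → d < q → B ≢ A →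
                     degDiff (A * q + c) (B * q + d) ≡ suc (degDiff A B)
  degDiff-digits-≢ A B c<q d<q B≢A = trans (cong deg (decode-digits-⊝ A B c<q d<q))
    (deg-cons-≢[] _ (⊝-decode≢[] (decode A) (B≢A ∘ flip trans (δ-decode A))))

  degDiff-digits-≡ : ∀ A {c d} → c < q → d < q → degDiff (A * q + c) (A * q + d) ≡ 0
  degDiff-digits-≡ A c<q d<q = trans (cong deg (decode-digits-⊝ A A c<q d<q))
    (trans (cong (deg ∘ cons e) (~⇒⊝≡[] {decode A} ~-refl)) (deg-cons-[] e))
    where e = fromℕ< c<q +F (-F fromℕ< d<q)

  -- For k < Aq + c: if k / q = A the difference is a constant; otherwise k = Bq + d with B < A,
  -- and each B contributes q differences of degree 1 + degDiff A B.
  degFact-digits : ∀ A {c} → c < q → degFact (A * q + c) ≡ q * (A + degFact A)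
  degFact-digits A {c} c<q = begin
    ∑ (A * q + c) (degDiff N)
      ≡⟨ ∑-+ (A * q) c (degDiff N) ⟩
    ∑ (A * q) (degDiff N) + ∑ c (λ d → degDiff N (A * q + d))
      ≡⟨ cong₂ _+_ (∑-* A q (degDiff N))
                   (∑-cong c (λ d d<c → degDiff-digits-≡ A c<q (ℕ.<-trans d<c c<q))) ⟩
    ∑ A (λ B → ∑ q (λ d → degDiff N (B * q + d))) + ∑ c (λ _ → 0)
      ≡⟨ cong₂ _+_ (∑-cong A (λ B B<A → ∑-cong q (λ d d<q →
                      degDiff-digits-≢ A B c<q d<q (ℕ.<⇒≢ B<A))))
                   (trans (∑-const c 0) (ℕ.*-zeroʳ c)) ⟩
    ∑ A (λ B → ∑ q (λ _ → suc (degDiff A B))) + 0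
      ≡⟨ ℕ.+-identityʳ _ ⟩
    ∑ A (λ B → ∑ q (λ _ → suc (degDiff A B)))
      ≡⟨ ∑-cong A (λ B _ → ∑-const q (suc (degDiff A B))) ⟩
    ∑ A (λ B → q * suc (degDiff A B))
      ≡⟨ ∑-*ˡ A q (suc ∘ degDiff A) ⟩
    q * ∑ A (suc ∘ degDiff A)
      ≡⟨ cong (q *_) (∑-suc A (degDiff A)) ⟩
    q * (A + degFact A)
      ∎
    where
    open ≡-Reasoning
    N = A * q + c

  degFact-/ : ∀ N → degFact N ≡ q * (N / q + degFact (N / q))
  degFact-/ N = trans (cong degFact N≡) (degFact-digits (N / q) (m%n<n N q))
    where
    N≡ : N ≡ N / q * q + N % q
    N≡ = trans (m≡m%n+[m/n]*n N q) (ℕ.+-comm (N % q) _)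

  degFact-mono : ∀ {M N} → M ≤ N → degFact M ≤ degFact N
  degFact-mono {M} {N} = <-rec (λ N → ∀ {M} → M ≤ N → degFact M ≤ degFact N) go N
    where
    go : ∀ N → (∀ {N′} → N′ < N → ∀ {M} → M ≤ N′ → degFact M ≤ degFact N′) →
         ∀ {M} → M ≤ N → degFact M ≤ degFact N
    go zero      _   z≤n = ℕ.≤-refl
    go N@(suc _) rec {M} M≤N = subst₂ _≤_ (sym (degFact-/ M)) (sym (degFact-/ N))
      (ℕ.*-monoʳ-≤ q (ℕ.+-mono-≤ M/q≤N/q (rec (m/n<m N q 1<q) M/q≤N/q)))
      where
      M/q≤N/q : M / q ≤ N / q
      M/q≤N/q = /-monoˡ-≤ q M≤N

  degFact-< : ∀ {M} U → M < U * q → degFact M < degFact (U * q)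
  degFact-< {M} U M<Uq = begin-strict
    degFact M                        ≡⟨ degFact-/ M ⟩
    q * (M / q + degFact (M / q))    <⟨ ℕ.*-monoʳ-< q (ℕ.+-mono-<-≤ M/q<U (degFact-mono (ℕ.<⇒≤ M/q<U))) ⟩
    q * (U + degFact U)              ≡⟨ degFact-digits U (s≤s z≤n) ⟨
    degFact (U * q + 0)              ≡⟨ cong degFact (ℕ.+-identityʳ (U * q)) ⟩
    degFact (U * q)                  ∎
    where
    open ℕ.≤-Reasoning
    M/q<U : M / q < U
    M/q<U = m<n*o⇒m/o<n M<Uq

  deg-fact : ∀ g → (fact g ≢ []) × (deg (fact g) ≡ degFact (δ g))
  deg-fact g with deg-∏ (δ g) (λ n → g ⊝ decode n) (λ n → Normal-⊝ g (decode n))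
                        (λ n n<δg → ⊝-decode≢[] g (ℕ.<⇒≢ n<δg))
  ... | ∏≢[] , deg∏ =
    subst (_≢ []) (sym (fact≡∏ g)) ∏≢[] ,
    trans (cong deg (fact≡∏ g)) (trans deg∏ (∑-cong (δ g) (λ n _ → cong deg (factor≡ n))))
    where
    factor≡ : ∀ n → g ⊝ decode n ≡ decode (δ g) ⊝ decode n
    factor≡ n = ⊝-cong (~decode-δ g) (~-refl {decode n})

  -- Changing the constant term to 0 multiplies the factorial by a unit

  ∷⊝decode-digit : ∀ c x B (i : Fin q) →
                   (c ∷ x) ⊝ decode (B * q + toℕ i) ≡ cons (c +F (-F i)) (x ⊝ decode B)
  ∷⊝decode-digit c x B i =
    trans (⊝-cong (~-refl {c ∷ x}) (decode-digit B i)) (∷⊝∷ c x i (decode B))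

  fact-block : ∀ c x B →
               ∏ q (λ d → (c ∷ x) ⊝ decode (B * q + d)) ~ ∏ q (λ d → cons 0F x ⊝ decode (B * q + d))
  fact-block c x B = ∏-permute (λ d → (c ∷ x) ⊝ decode (B * q + d)) (λ d → cons 0F x ⊝ decode (B * q + d))
                               (translation c) (~-reflexive ∘ factor≡)
    where
    open ≡-Reasoning
    factor≡ : ∀ i → (c ∷ x) ⊝ decode (B * q + toℕ i) ≡ cons 0F x ⊝ decode (B * q + toℕ (i +F (-F c)))
    factor≡ i = begin
      (c ∷ x) ⊝ decode (B * q + toℕ i)   ≡⟨ ∷⊝decode-digit c x B i ⟩
      cons (c +F (-F i)) (x ⊝ decode B)  ≡⟨ cong (λ e → cons e (x ⊝ decode B)) (0-[i-c]≡c-i c i) ⟨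
      cons (0F +F (-F j)) (x ⊝ decode B) ≡⟨ ∷⊝decode-digit 0F x B j ⟨
      (0F ∷ x) ⊝ decode (B * q + toℕ j)  ≡⟨ ⊝-cong (~-sym (cons~∷ 0F x)) (~-refl {decode (B * q + toℕ j)}) ⟩
      cons 0F x ⊝ decode (B * q + toℕ j) ∎
      where j = i +F (-F c)

  -- the factors g - h of g! with h = a_i + t x, i < c, where g = c + t x
  lowFactors : Fin q → List (Fin q) → List (Fin q)
  lowFactors c x = ∏ (toℕ c) (λ i → (c ∷ x) ⊝ decode (δ x * q + i))

  Unit-lowFactors : ∀ c x → c ≢ 0F → Unit (lowFactors c x)
  Unit-lowFactors c x c≢0 = Unit-∏ (toℕ c) _ λ i i<c →
    let i<q = ℕ.<-trans i<c (toℕ<n c)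
        e   = c +F (-F fromℕ< i<q)
        e≢0 = ≢⇒-≢0 λ c≡i → ℕ.<⇒≢ i<c (trans (sym (toℕ-fromℕ< i<q)) (cong toℕ (sym c≡i)))
    in subst Unit (sym (begin
      (c ∷ x) ⊝ decode (δ x * q + i)
                                  ≡⟨ cong (λ d → (c ∷ x) ⊝ decode (δ x * q + d)) (toℕ-fromℕ< i<q) ⟨
      (c ∷ x) ⊝ decode (δ x * q + toℕ (fromℕ< i<q))  ≡⟨ ∷⊝decode-digit c x (δ x) (fromℕ< i<q) ⟩
      cons e (x ⊝ decode (δ x))                      ≡⟨ cong (cons e) (~⇒⊝≡[] (~decode-δ x)) ⟩
      cons e []                                      ≡⟨ cons-≢0-[] e≢0 ⟩
      e ∷ []                                         ∎))
    (Unit-constant e≢0)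
    where open ≡-Reasoning

  fact-∷ : ∀ c x → fact (c ∷ x) ~ fact (cons 0F x) ⊗ lowFactors c x
  fact-∷ c x = begin
    fact (c ∷ x)                                            ≡⟨ fact≡∏ (c ∷ x) ⟩
    ∏ (δ (c ∷ x)) G                                         ≡⟨ cong (λ N → ∏ N G) (δ-∷ c x) ⟩
    ∏ (δ x * q + toℕ c) G                                   ≈⟨ ∏-+ (δ x * q) (toℕ c) G ⟩
    ∏ (δ x * q) G ⊗ lowFactors c x                          ≈⟨ ⊗-cong (∏-* (δ x) q G) ~-refl ⟩
    ∏ (δ x) (λ B → ∏ q (λ d → G (B * q + d))) ⊗ lowFactors c x
                                        ≈⟨ ⊗-cong (∏-cong (δ x) (λ B _ → fact-block c x B)) ~-refl ⟩
    ∏ (δ x) (λ B → ∏ q (λ d → H (B * q + d))) ⊗ lowFactors c x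
                                        ≈⟨ ⊗-cong (∏-* (δ x) q H) ~-refl ⟨
    ∏ (δ x * q) H ⊗ lowFactors c x                          ≡⟨ cong (λ N → ∏ N H ⊗ lowFactors c x) δT≡ ⟨
    ∏ (δ (cons 0F x)) H ⊗ lowFactors c x                    ≡⟨ cong (_⊗ lowFactors c x) (fact≡∏ (cons 0F x)) ⟨
    fact (cons 0F x) ⊗ lowFactors c x                       ∎
    where
    open ~-Reasoning
    G H : ℕ → List (Fin q)
    G n = (c ∷ x) ⊝ decode n
    H n = cons 0F x ⊝ decode n
    δT≡ : δ (cons 0F x) ≡ δ x * q
    δT≡ = trans (δ-cons 0F x) (δ-0∷ x)

  -- The values of S

  IsS⇒coeff0≡0 : ∀ f g → Normal g → IsS f g → coeff g 0 ≡ 0F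
  IsS⇒coeff0≡0 f []      _  _                   = refl
  IsS⇒coeff0≡0 f (c ∷ x) ng (f≡[]⇒g≡[] , S-spec) with c ≟ᶠ 0F
  ... | yes c≡0 = c≡0
  ... | no  c≢0 = ⊥-elim (ℕ.<⇒≱ δT<δg (minimal T (Normal-cons 0F x (Normal-∷⁻ c x ng)) f∣T!))
    where
    T = cons 0F x
    f≢[] : f ≢ []
    f≢[] f≡[] with f≡[]⇒g≡[] f≡[]
    ... | ()
    minimal = proj₂ (S-spec f≢[])
    f∣T! : f ∣P fact T
    f∣T! = ∣P-cancel-Unit {f} (Normal-fact T) (Unit-lowFactors c x c≢0) (fact-∷ c x)
                          (proj₁ (S-spec f≢[]))
    δT<δg : δ T < δ (c ∷ x)
    δT<δg = subst₂ _<_ (sym (trans (δ-cons 0F x) (δ-0∷ x))) (sym (δ-∷ c x))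
      (ℕ.m<m+n (δ x * q) (ℕ.n≢0⇒n>0 λ c≡0 → c≢0 (toℕ-injective (trans c≡0 (sym zero-index)))))

  fact∣P-fact⇒δ≤ : ∀ g k U → δ g ≡ U * q → fact g ∣P fact k → δ g ≤ δ k
  fact∣P-fact⇒δ≤ g k U δg≡ g!∣k! = ℕ.≮⇒≥ λ δk<δg → ℕ.<⇒≱
    (degFact-< U (subst (δ k <_) δg≡ δk<δg))
    (subst (_≤ degFact (δ k)) (cong degFact δg≡)
      (subst₂ _≤_ (proj₂ (deg-fact g)) (proj₂ (deg-fact k))
        (∣P⇒deg≤ (Normal-fact g) (proj₁ (deg-fact g)) (proj₁ (deg-fact k)) g!∣k!)))

  IsS-fact : ∀ g → tPoly ∣P g → IsS (fact g) g
  IsS-fact g (h , t⊗h≡g) =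
    (λ g!≡[] → ⊥-elim (proj₁ (deg-fact g) g!≡[])) ,
    λ _ → (one , g!⊗one≡g!) , λ k _ → fact∣P-fact⇒δ≤ g k (δ h) δg≡
    where
    g!⊗one≡g! : fact g ⊗ one ≡ fact g
    g!⊗one≡g! = Normal-~⇒≡ (Normal-⊗ (fact g) one) (Normal-fact g) (⊗-identityʳ (fact g))
    δg≡ : δ g ≡ δ h * q
    δg≡ = trans (cong δ (sym t⊗h≡g)) (trans (δ-cong (~-trans (⊗~mulL tPoly h) (mulL-tPoly h))) (δ-0∷ h))

2≤size : ∀ {q} → FiniteField q → 2 ≤ q
2≤size {zero}        F = ⊥-elim (Fin0-empty (FiniteField.0F F))
  where
  Fin0-empty : Fin 0 → ⊥
  Fin0-empty ()
2≤size {suc zero}    F = ⊥-elim (FiniteField.0≢1 F (Fin1-unique (FiniteField.0F F) (FiniteField.1F F)))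
  where
  Fin1-unique : (a b : Fin 1) → a ≡ b
  Fin1-unique Fin.zero Fin.zero = refl
2≤size {suc (suc q)} F = s≤s (s≤s z≤n)

proposition3p8 : ∀ {q : ℕ} (F : FiniteField q) → let open Poly F in
    (∀ (f g : List (Fin q)) → Normal f → Normal g → IsS f g → tPoly ∣P g)
    × (∀ (g : List (Fin q)) → Normal g → tPoly ∣P g →
         ∃ λ (f : List (Fin q)) → Normal f × IsS f g)
proposition3p8 F with 2≤size F
... | s≤s (s≤s _) =
  (λ f g _ ng g≡Sf → coeff0≡0⇒tPoly∣P ng (IsS⇒coeff0≡0 f g ng g≡Sf)) ,
  (λ g _ t∣g → fact g , Normal-fact g , IsS-fact g t∣g)
  where
  open Poly F
  open PolynomialArithmetic F
  open Factorials F
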